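{- Let $\mathcal{D}$ be a finite structure with domain $D$ and let $U,X\subseteq D$ be sets selected as in the definition of a $U$-$X$-core of $\mathcal{D}$, and assume $U\cup X=D$. Then every surjective hyper-endomorphism of $\mathcal{D}$ is in the 3-permuted form with respect to $U,X$. Moreover, every surjective hyper-endomorphism $f$ of $\mathcal{D}$ that is $U$-surjective and $X$-total additionally satisfies $f(U\setminus X)\cap X=\bigcup_{u\in U\setminus X}X_u=X\setminus U$, where the sets $X_u$ are those of its 3-permuted form.
   Context: Structures are finite relational structures with nonempty domain. A shop of $D$ is a map $f$ from $D$ to the power set of $D$ with $f(d)\neq\emptyset$ for all $d$ and $\bigcup_d f(d)=D$; it is a surjective hyper-endomorphism of $\mathcal{D}$ if for each relation $R$ of arity $i$, $R(a_1,\dots,a_i)$ in $\mathcal{D}$ implies $R(b_1,\dots,b_i)$ in $\mathcal{D}$ for all $b_j\in f(a_j)$. $f(S)=\bigcup_{s\in S}f(s)$; $f$ is $U$-surjective if $f(U)=D$ and $X$-total if $f(d)\cap X\neq\emptyset$ for all $d$. Selection of $U,X$ for a $U$-$X$-core: $U$ has minimum cardinality among subsets $U'$ for which a $U'$-surjective surjective hyper-endomorphism exists, $X$ has minimum cardinality among subsets $X'$ for which an $X'$-total surjective hyper-endomorphism exists, and among such choices $|U\cap X|$ is maximum. A shop $f$ is in the 3-permuted form (w.r.t. $U,X$) if there are a permutation $\zeta$ of $X\cap U$, a permutation $\chi$ of $X\setminus U$ and a permutation $\upsilon$ of $U\setminus X$ such that $f(y)=\{\zeta(y)\}$ for $y\in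 U\cap X$, $f(x)=\{\chi(x)\}$ for $x\in X\setminus U$, and $f(u)=\{\upsilon(u)\}\cup X_u$ with $X_u\subseteq X\setminus U$ for $u\in U\setminus X$. -}

module Defs where

open import Data.Nat using (ℕ; suc; _≤_)
open import Data.Fin using (Fin)
open import Data.Fin.Subset using (Subset; _∈_; _⊆_; _∩_; _∪_; _─_; ∣_∣; ⁅_⁆; Nonempty; ⊤)
open import Data.Vec using (Vec; lookup)
open import Data.Bool using (Bool; true)
open import Data.Product using (Σ; ∃; _×_)
open import Data.Sum using (_⊎_)
open import Relation.Binary.PropositionalEquality using (_≡_)

record Structure : Set where
  field
    k     : ℕ                      -- domain is Fin (suc k), hence nonempty
    nrel  : ℕ
    arity : Fin nrel → ℕ
    rel   : (r : Fin nrel) → Vec (Fin (suc k)) (arity r) → Bool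

module _ (𝒟 : Structure) where
  open Structure 𝒟

  Dom : Set
  Dom = Fin (suc k)

  HMap : Set
  HMap = Dom → Subset (suc k)

  InImage : HMap → Subset (suc k) → Dom → Set
  InImage f S y = Σ Dom λ d → d ∈ S × y ∈ f d

  IsShop : HMap → Set
  IsShop f = (∀ d → Nonempty (f d)) × (∀ y → InImage f ⊤ y)

  IsSHE : HMap → Set
  IsSHE f = IsShop f ×
    (∀ (r : Fin nrel) (a b : Vec Dom (arity r)) →
       rel r a ≡ true → (∀ j → lookup b j ∈ f (lookup a j)) → rel r b ≡ true)

  USurjective : Subset (suc k) → HMap → Set
  USurjective U f = ∀ y → InImage f U y

  XTotal : Subset (suc k) → HMap → Set
  XTotal X f = ∀ d → Σ Dom λ x → x ∈ X × x ∈ f d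

  MinSurjSet : Subset (suc k) → Set
  MinSurjSet U = (Σ HMap λ f → IsSHE f × USurjective U f) ×
    (∀ U' → (Σ HMap λ f → IsSHE f × USurjective U' f) → ∣ U ∣ ≤ ∣ U' ∣)

  MinTotalSet : Subset (suc k) → Set
  MinTotalSet X = (Σ HMap λ f → IsSHE f × XTotal X f) ×
    (∀ X' → (Σ HMap λ f → IsSHE f × XTotal X' f) → ∣ X ∣ ≤ ∣ X' ∣)

  SelectedUX : Subset (suc k) → Subset (suc k) → Set
  SelectedUX U X = MinSurjSet U × MinTotalSet X ×
    (∀ U' X' → MinSurjSet U' → MinTotalSet X' → ∣ U' ∩ X' ∣ ≤ ∣ U ∩ X ∣)

  PermOn : Subset (suc k) → (Dom → Dom) → Set
  PermOn S g = (∀ x → x ∈ S → g x ∈ S) ×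
    (∀ x y → x ∈ S → y ∈ S → g x ≡ g y → x ≡ y) ×
    (∀ y → y ∈ S → Σ Dom λ x → x ∈ S × g x ≡ y)

  record ThreePermuted (U X : Subset (suc k)) (f : HMap) : Set where
    field
      ζ χ υ : Dom → Dom
      Xs    : Dom → Subset (suc k)
      ζ-perm : PermOn (X ∩ U) ζ
      χ-perm : PermOn (X ─ U) χ
      υ-perm : PermOn (U ─ X) υ
      ζ-form : ∀ y → y ∈ U ∩ X → f y ≡ ⁅ ζ y ⁆
      χ-form : ∀ x → x ∈ X ─ U → f x ≡ ⁅ χ x ⁆
      υ-form : ∀ u → u ∈ U ─ X → f u ≡ ⁅ υ u ⁆ ∪ Xs u
      Xs-sub : ∀ u → u ∈ U ─ X → Xs u ⊆ X ─ U

-- Minimality of U and of X forces every surjective hyper-endomorphism to have at most one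
-- point of U in each image and pairwise disjoint images on X: otherwise composing with a
-- witness of minimality yields a smaller surjecting or total set.  Maximality of |U ∩ X|
-- moreover forbids images of X ─ U from meeting U.  For H that is in addition U-surjective
-- and X-total, counting then produces one permutation θ of D preserving X ∩ U, X ─ U and
-- U ─ X with H d = {θ d} off U ─ X and H d ⊆ {θ d} ∪ (X ─ U) on U ─ X.  An arbitrary F
-- inherits such a permutation from the sandwich K ∘ F ∘ K, where K is composed from the
-- minimality witnesses: θ_F = θ_K⁻¹ ∘ θ_KFK ∘ θ_K⁻¹.  The description of the sets X_u then
-- only uses the 3-permuted form and U-surjectivity.
module Submission where

open import Data.Bool using (true)
open import Data.Empty using (⊥; ⊥-elim)
open import Data.Fin using (Fin; zero; suc) renaming (_≟_ to _≟ᶠ_)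
open import Data.Fin.Properties using (any?)
open import Data.Fin.Subset hiding (⊥)
open import Data.Fin.Subset.Properties
open import Data.Nat using (ℕ; zero; suc; _≤_; _<_; z≤n; s≤s)
import Data.Nat
open import Data.Nat.Properties using (≤-trans; ≤-<-trans; <⇒≱; suc-injective)
open import Data.Product using (Σ; _×_; _,_; proj₁; proj₂)
open import Data.Sum using (_⊎_; inj₁; inj₂)
open import Data.Vec using (Vec; _∷_; here; there; lookup; tabulate)
open import Data.Vec.Properties using ([]=⇒lookup; lookup⇒[]=; lookup∘tabulate)
open import Function.Bundles using (_⇔_; mk⇔)
open import Relation.Nullary using (Dec; yes; no; does; _×-dec_; contradiction)
open import Relation.Binary.PropositionalEquality
open import Defs

choice-through : {A B : Set} {R : A → B → Set} (y₀ : B) → (∀ x → Dec (R x y₀)) → (∀ x → Σ B (R x)) →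
                 Σ (A → B) λ p → (∀ x → R x (p x)) × (∀ x → R x y₀ → p x ≡ y₀)
choice-through {A} {B} {R} y₀ R?y₀ total = p , p-spec , p-through
  where
  p : A → B
  p x with R?y₀ x
  ... | yes _ = y₀
  ... | no _  = proj₁ (total x)
  p-spec : ∀ x → R x (p x)
  p-spec x with R?y₀ x
  ... | yes r = r
  ... | no _  = proj₂ (total x)
  p-through : ∀ x → R x y₀ → p x ≡ y₀
  p-through x r with R?y₀ x
  ... | yes _  = refl
  ... | no ¬r = ⊥-elim (¬r r)

x∈p─q⇒x∉q : ∀ {n} {p q : Subset n} {x} → x ∈ p ─ q → x ∉ q
x∈p─q⇒x∉q {p = _ ∷ p} {inside  ∷ q} {zero}  ()        here
x∈p─q⇒x∉q {p = _ ∷ p} {outside ∷ q} {zero}  _         ()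
x∈p─q⇒x∉q {p = _ ∷ p} {_       ∷ q} {suc x} (there m) (there k) = x∈p─q⇒x∉q {p = p} m k

∣p∣≡1+∣p-x∣ : ∀ {n} (p : Subset n) {x} → x ∈ p → ∣ p ∣ ≡ suc ∣ p - x ∣
∣p∣≡1+∣p-x∣ (inside  ∷ p) here      = cong suc (cong ∣_∣ (sym (p─⊥≡p p)))
∣p∣≡1+∣p-x∣ (inside  ∷ p) (there m) = cong suc (∣p∣≡1+∣p-x∣ p m)
∣p∣≡1+∣p-x∣ (outside ∷ p) (there m) = ∣p∣≡1+∣p-x∣ p m

module _ {n : ℕ} where

  MapsTo : Subset n → Subset n → (Fin n → Fin n) → Set
  MapsTo S T ψ = ∀ {x} → x ∈ S → ψ x ∈ T

  InjectiveOn : Subset n → (Fin n → Fin n) → Set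
  InjectiveOn S ψ = ∀ {x y} → x ∈ S → y ∈ S → ψ x ≡ ψ y → x ≡ y

  SurjectiveOn : Subset n → (Fin n → Fin n) → Set
  SurjectiveOn S ψ = ∀ {y} → y ∈ S → Σ (Fin n) λ x → x ∈ S × ψ x ≡ y

  injection⇒∣p∣≤∣q∣ : ∀ {S T ψ} → MapsTo S T ψ → InjectiveOn S ψ → ∣ S ∣ ≤ ∣ T ∣
  injection⇒∣p∣≤∣q∣ {S} {T} {ψ} = go ∣ S ∣ refl
    where
    go : ∀ m {S T} → ∣ S ∣ ≡ m → MapsTo S T ψ → InjectiveOn S ψ → ∣ S ∣ ≤ ∣ T ∣
    go zero    ∣S∣≡0 _ _ rewrite ∣S∣≡0 = z≤n
    go (suc m) {S} {T} ∣S∣≡1+m maps inj with nonempty? S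
    ... | no ¬ne = contradiction (trans (sym (∣⊥∣≡0 n)) (trans (cong ∣_∣ (sym (Empty-unique ¬ne))) ∣S∣≡1+m)) λ ()
    ... | yes (s , s∈S) rewrite ∣p∣≡1+∣p-x∣ S s∈S | ∣p∣≡1+∣p-x∣ T (maps s∈S) =
      s≤s (go m (suc-injective ∣S∣≡1+m) maps′ inj′)
      where
      maps′ : MapsTo (S - s) (T - ψ s) ψ
      maps′ x∈S-s = x∈p∧x≢y⇒x∈p-y (maps (p─q⊆p S _ x∈S-s)) λ ψx≡ψs →
        x∈p─q⇒x∉q x∈S-s (subst (_∈ ⁅ s ⁆) (sym (inj (p─q⊆p S _ x∈S-s) s∈S ψx≡ψs)) (x∈⁅x⁆ s))
      inj′ : InjectiveOn (S - s) ψ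
      inj′ x∈ y∈ = inj (p─q⊆p S _ x∈) (p─q⊆p S _ y∈)

  injective⇒surjective : ∀ {S ψ} → MapsTo S S ψ → InjectiveOn S ψ → SurjectiveOn S ψ
  injective⇒surjective {S} {ψ} maps inj {y} y∈S with any? (λ x → (x ∈? S) ×-dec (ψ x ≟ᶠ y))
  ... | yes hit = hit
  ... | no ¬hit = contradiction (injection⇒∣p∣≤∣q∣ maps′ inj) (<⇒≱ (x∈p⇒∣p-x∣<∣p∣ y∈S))
    where
    maps′ : MapsTo S (S - y) ψ
    maps′ {x} x∈S = x∈p∧x≢y⇒x∈p-y (maps x∈S) λ ψx≡y → ¬hit (x , x∈S , ψx≡y)

  abstract
    setOf : {P : Fin n → Set} → (∀ x → Dec (P x)) → Subset n
    setOf P? = tabulate λ x → does (P? x)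

    ∈setOf⁺ : {P : Fin n → Set} (P? : ∀ x → Dec (P x)) → ∀ {x} → P x → x ∈ setOf P?
    ∈setOf⁺ {P} P? {x} px = lookup⇒[]= x _ (trans (lookup∘tabulate _ x) (true-if (P? x)))
      where
      true-if : (d : Dec (P x)) → does d ≡ true
      true-if (yes _) = refl
      true-if (no ¬p) = contradiction px ¬p

    ∈setOf⁻ : {P : Fin n → Set} (P? : ∀ x → Dec (P x)) → ∀ {x} → x ∈ setOf P? → P x
    ∈setOf⁻ {P} P? {x} x∈ = holds (P? x) (trans (sym (lookup∘tabulate _ x)) ([]=⇒lookup x∈))
      where
      holds : (d : Dec (P x)) → does d ≡ true → P x
      holds (yes p) _ = p

    choose : {P : Fin n → Set} → (∀ x → Dec (P x)) → Fin n → Fin n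
    choose P? default with any? P?
    ... | yes (x , _) = x
    ... | no _        = default

    choose-spec : {P : Fin n → Set} (P? : ∀ x → Dec (P x)) (default : Fin n) → Σ (Fin n) P → P (choose P? default)
    choose-spec P? default witness with any? P?
    ... | yes (_ , px) = px
    ... | no ¬any      = contradiction witness ¬any

    choose-default : {P : Fin n → Set} (P? : ∀ x → Dec (P x)) (default : Fin n) →
                     P (choose P? default) ⊎ choose P? default ≡ default
    choose-default P? default with any? P?
    ... | yes (_ , px) = inj₁ px
    ... | no _         = inj₂ refl

  image : (Fin n → Fin n) → Subset n → Subset n
  image ψ S = setOf λ y → any? λ x → (x ∈? S) ×-dec (ψ x ≟ᶠ y)

  ∈image⁺ : ∀ ψ S {x} → x ∈ S → ψ x ∈ image ψ S
  ∈image⁺ ψ S x∈S = ∈setOf⁺ (λ y → any? λ x → (x ∈? S) ×-dec (ψ x ≟ᶠ y)) (_ , x∈S , refl)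

  ∈image⁻ : ∀ ψ S {y} → y ∈ image ψ S → Σ (Fin n) λ x → x ∈ S × ψ x ≡ y
  ∈image⁻ ψ S = ∈setOf⁻ (λ y → any? λ x → (x ∈? S) ×-dec (ψ x ≟ᶠ y))

  ∣image∣≤∣p∣ : ∀ ψ S → ∣ image ψ S ∣ ≤ ∣ S ∣
  ∣image∣≤∣p∣ ψ S = injection⇒∣p∣≤∣q∣ (λ y∈ → proj₁ (section y∈)) λ y₁∈ y₂∈ eq →
    trans (sym (proj₂ (section y₁∈))) (trans (cong ψ eq) (proj₂ (section y₂∈)))
    where
    preimage : Fin n → Fin n
    preimage y = choose (λ x → (x ∈? S) ×-dec (ψ x ≟ᶠ y)) y
    section : ∀ {y} → y ∈ image ψ S → preimage y ∈ S × ψ (preimage y) ≡ y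
    section {y} y∈ = choose-spec (λ x → (x ∈? S) ×-dec (ψ x ≟ᶠ y)) y (∈image⁻ ψ S y∈)

  collision⇒∣image∣<∣p∣ : ∀ ψ S {x₁ x₂} → x₁ ∈ S → x₂ ∈ S → x₁ ≢ x₂ → ψ x₁ ≡ ψ x₂ → ∣ image ψ S ∣ < ∣ S ∣
  collision⇒∣image∣<∣p∣ ψ S {x₁} {x₂} x₁∈S x₂∈S x₁≢x₂ collide =
    ≤-<-trans (≤-trans (p⊆q⇒∣p∣≤∣q∣ image⊆) (∣image∣≤∣p∣ ψ (S - x₂))) (x∈p⇒∣p-x∣<∣p∣ x₂∈S)
    where
    image⊆ : image ψ S ⊆ image ψ (S - x₂)
    image⊆ y∈ with ∈image⁻ ψ S y∈
    ... | x , x∈S , refl with x ≟ᶠ x₂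
    ...   | yes refl = subst (_∈ image ψ (S - x₂)) collide (∈image⁺ ψ (S - x₂) (x∈p∧x≢y⇒x∈p-y x₁∈S x₁≢x₂))
    ...   | no x≢x₂  = ∈image⁺ ψ (S - x₂) (x∈p∧x≢y⇒x∈p-y x∈S x≢x₂)

  infixr 9 _∘ʰ_
  _∘ʰ_ : (Fin n → Subset n) → (Fin n → Subset n) → Fin n → Subset n
  (F ∘ʰ G) d = setOf λ z → any? λ e → (e ∈? G d) ×-dec (z ∈? F e)

  ∈∘ʰ⁺ : ∀ F G {d e z} → e ∈ G d → z ∈ F e → z ∈ (F ∘ʰ G) d
  ∈∘ʰ⁺ F G {d} e∈ z∈ = ∈setOf⁺ (λ z → any? λ e → (e ∈? G d) ×-dec (z ∈? F e)) (_ , e∈ , z∈)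

  ∈∘ʰ⁻ : ∀ F G {d z} → z ∈ (F ∘ʰ G) d → Σ (Fin n) λ e → e ∈ G d × z ∈ F e
  ∈∘ʰ⁻ F G {d} = ∈setOf⁻ (λ z → any? λ e → (e ∈? G d) ×-dec (z ∈? F e))

  singleton-intro : ∀ {S : Subset n} {z} → z ∈ S → (∀ {e} → e ∈ S → e ≡ z) → S ≡ ⁅ z ⁆
  singleton-intro {S} {z} z∈S only-z = ⊆-antisym
    (λ e∈S → subst (_∈ ⁅ z ⁆) (sym (only-z e∈S)) (x∈⁅x⁆ z))
    (λ e∈⁅z⁆ → subst (_∈ S) (sym (x∈⁅y⁆⇒x≡y z e∈⁅z⁆)) z∈S)

module _ (𝒟 : Structure) where
  open Structure 𝒟

  module _ {F : HMap 𝒟} (F-she : IsSHE 𝒟 F) where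

    she-nonempty : ∀ d → Σ (Dom 𝒟) λ e → e ∈ F d
    she-nonempty = proj₁ (proj₁ F-she)

    she-preimage : ∀ y → Σ (Dom 𝒟) λ d → y ∈ F d
    she-preimage y = let d , _ , y∈Fd = proj₂ (proj₁ F-she) y in d , y∈Fd

  ∘ʰ-isSHE : ∀ {F G} → IsSHE 𝒟 F → IsSHE 𝒟 G → IsSHE 𝒟 (F ∘ʰ G)
  ∘ʰ-isSHE {F} {G} F-she G-she = (nonempty , covering) , preserves
    where
    nonempty : ∀ d → Nonempty ((F ∘ʰ G) d)
    nonempty d = let e , e∈ = she-nonempty G-she d ; z , z∈ = she-nonempty F-she e in z , ∈∘ʰ⁺ F G e∈ z∈
    covering : ∀ y → InImage 𝒟 (F ∘ʰ G) ⊤ y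
    covering y = let e , y∈ = she-preimage F-she y ; d , e∈ = she-preimage G-she e in d , ∈⊤ , ∈∘ʰ⁺ F G e∈ y∈
    preserves : ∀ r (a b : Vec (Dom 𝒟) (arity r)) → rel r a ≡ true →
                (∀ j → lookup b j ∈ (F ∘ʰ G) (lookup a j)) → rel r b ≡ true
    preserves r a b ra b∈ = proj₂ F-she r c b (proj₂ G-she r a c ra c∈) b∈′
      where
      c : Vec (Dom 𝒟) (arity r)
      c = tabulate λ j → proj₁ (∈∘ʰ⁻ F G (b∈ j))
      c∈ : ∀ j → lookup c j ∈ G (lookup a j)
      c∈ j rewrite lookup∘tabulate (λ j → proj₁ (∈∘ʰ⁻ F G (b∈ j))) j = proj₁ (proj₂ (∈∘ʰ⁻ F G (b∈ j)))
      b∈′ : ∀ j → lookup b j ∈ F (lookup c j)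
      b∈′ j rewrite lookup∘tabulate (λ j → proj₁ (∈∘ʰ⁻ F G (b∈ j))) j = proj₂ (proj₂ (∈∘ʰ⁻ F G (b∈ j)))

  ∘ʰ-USurjective : ∀ {U F G} → IsSHE 𝒟 F → USurjective 𝒟 U G → USurjective 𝒟 U (F ∘ʰ G)
  ∘ʰ-USurjective {F = F} {G} F-she G-surj y =
    let e , y∈ = she-preimage F-she y ; d , d∈U , e∈ = G-surj e in d , d∈U , ∈∘ʰ⁺ F G e∈ y∈

  ∘ʰ-XTotal : ∀ {X F G} → XTotal 𝒟 X F → IsSHE 𝒟 G → XTotal 𝒟 X (F ∘ʰ G)
  ∘ʰ-XTotal {F = F} {G} F-tot G-she d =
    let e , e∈ = she-nonempty G-she d ; x , x∈X , x∈ = F-tot e in x , x∈X , ∈∘ʰ⁺ F G e∈ x∈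

  injective⇒PermOn : ∀ {S ψ} → MapsTo S S ψ → InjectiveOn S ψ → PermOn 𝒟 S ψ
  injective⇒PermOn maps inj = (λ _ → maps) , (λ _ _ → inj) , λ _ → injective⇒surjective maps inj

  module _ {U X : Subset (suc k)} {f : HMap 𝒟} (w : ThreePermuted 𝒟 U X f) where
    open ThreePermuted w

    ∈f[U─X]∩X⇒∈Xs : ∀ {u y} → u ∈ U ─ X → y ∈ f u → y ∈ X → y ∈ Xs u
    ∈f[U─X]∩X⇒∈Xs {u} {y} u∈ y∈ y∈X with x∈p∪q⁻ ⁅ υ u ⁆ (Xs u) (subst (y ∈_) (υ-form u u∈) y∈)
    ... | inj₁ y∈⁅υu⁆ = contradiction y∈X (x∈p─q⇒x∉q y∈U─X)
      where
      y∈U─X : y ∈ U ─ X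
      y∈U─X = subst (_∈ U ─ X) (sym (x∈⁅y⁆⇒x≡y (υ u) y∈⁅υu⁆)) (proj₁ υ-perm u u∈)
    ... | inj₂ y∈Xs = y∈Xs

    Xs⊆f : ∀ {u} → u ∈ U ─ X → Xs u ⊆ f u
    Xs⊆f {u} u∈ y∈ = subst (_ ∈_) (sym (υ-form u u∈)) (x∈p∪q⁺ (inj₂ y∈))

    X∩f[U─X]⇔⋃Xs : ∀ y → (y ∈ X × InImage 𝒟 f (U ─ X) y) ⇔ (Σ (Dom 𝒟) λ u → u ∈ U ─ X × y ∈ Xs u)
    X∩f[U─X]⇔⋃Xs y = mk⇔ (λ (y∈X , u , u∈ , y∈) → u , u∈ , ∈f[U─X]∩X⇒∈Xs u∈ y∈ y∈X)
                          (λ (u , u∈ , y∈) → p─q⊆p X U (Xs-sub u u∈ y∈) , u , u∈ , Xs⊆f u∈ y∈)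

    ⋃Xs⇔X─U : USurjective 𝒟 U f → ∀ y → (Σ (Dom 𝒟) λ u → u ∈ U ─ X × y ∈ Xs u) ⇔ y ∈ X ─ U
    ⋃Xs⇔X─U f-surj y = mk⇔ (λ (u , u∈ , y∈) → Xs-sub u u∈ y∈) from
      where
      from : y ∈ X ─ U → Σ (Dom 𝒟) λ u → u ∈ U ─ X × y ∈ Xs u
      from y∈X─U with f-surj y
      ... | d , d∈U , y∈fd with d ∈? X
      ...   | no d∉X = d , d∈U─X , ∈f[U─X]∩X⇒∈Xs d∈U─X y∈fd (p─q⊆p X U y∈X─U)
        where
        d∈U─X : d ∈ U ─ X
        d∈U─X = x∈p∧x∉q⇒x∈p─q d∈U d∉X
      ...   | yes d∈X = contradiction y∈U (x∈p─q⇒x∉q y∈X─U)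
        where
        y≡ζd : y ≡ ζ d
        y≡ζd = x∈⁅y⁆⇒x≡y (ζ d) (subst (y ∈_) (ζ-form d (x∈p∩q⁺ (d∈U , d∈X))) y∈fd)
        y∈U : y ∈ U
        y∈U = subst (_∈ U) (sym y≡ζd) (proj₂ (x∈p∩q⁻ X U (proj₁ ζ-perm d (x∈p∩q⁺ (d∈X , d∈U)))))

module UXCore (𝒟 : Structure) {U X : Subset (suc (Structure.k 𝒟))}
              (selected : SelectedUX 𝒟 U X) (covering : U ∪ X ≡ ⊤) where
  open Structure 𝒟 using (k)

  private
    g : HMap 𝒟
    g = proj₁ (proj₁ (proj₁ selected))

    g-she : IsSHE 𝒟 g
    g-she = proj₁ (proj₂ (proj₁ (proj₁ selected)))

    g-surj : USurjective 𝒟 U g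
    g-surj = proj₂ (proj₂ (proj₁ (proj₁ selected)))

    U-minimal : ∀ U′ → (Σ (HMap 𝒟) λ f → IsSHE 𝒟 f × USurjective 𝒟 U′ f) → ∣ U ∣ ≤ ∣ U′ ∣
    U-minimal = proj₂ (proj₁ selected)

    h : HMap 𝒟
    h = proj₁ (proj₁ (proj₁ (proj₂ selected)))

    h-she : IsSHE 𝒟 h
    h-she = proj₁ (proj₂ (proj₁ (proj₁ (proj₂ selected))))

    h-tot : XTotal 𝒟 X h
    h-tot = proj₂ (proj₂ (proj₁ (proj₁ (proj₂ selected))))

    X-minimal : ∀ X′ → (Σ (HMap 𝒟) λ f → IsSHE 𝒟 f × XTotal 𝒟 X′ f) → ∣ X ∣ ≤ ∣ X′ ∣
    X-minimal = proj₂ (proj₁ (proj₂ selected))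

    U∩X-maximal : ∀ U′ X′ → MinSurjSet 𝒟 U′ → MinTotalSet 𝒟 X′ → ∣ U′ ∩ X′ ∣ ≤ ∣ U ∩ X ∣
    U∩X-maximal = proj₂ (proj₂ selected)

  U-images-subsingleton : ∀ {F} → IsSHE 𝒟 F → ∀ {d u₁ u₂} → u₁ ∈ U → u₂ ∈ U → u₁ ∈ F d → u₂ ∈ F d → u₁ ≡ u₂
  U-images-subsingleton {F} F-she {d} {u₁} {u₂} u₁∈U u₂∈U u₁∈ u₂∈ with u₁ ≟ᶠ u₂
  ... | yes u₁≡u₂ = u₁≡u₂
  ... | no u₁≢u₂ = contradiction (U-minimal (image p U) (g ∘ʰ F , ∘ʰ-isSHE 𝒟 g-she F-she , g∘F-surj))
                     (<⇒≱ (collision⇒∣image∣<∣p∣ p U u₁∈U u₂∈U u₁≢u₂ (trans (p-d u₁∈) (sym (p-d u₂∈)))))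
    where
    chosen : Σ (Dom 𝒟 → Dom 𝒟) λ p → (∀ u → u ∈ F (p u)) × (∀ u → u ∈ F d → p u ≡ d)
    chosen = choice-through d (λ u → u ∈? F d) (she-preimage 𝒟 F-she)
    p : Dom 𝒟 → Dom 𝒟
    p = proj₁ chosen
    p-d : ∀ {u} → u ∈ F d → p u ≡ d
    p-d = proj₂ (proj₂ chosen) _
    g∘F-surj : USurjective 𝒟 (image p U) (g ∘ʰ F)
    g∘F-surj y = let u , u∈U , y∈ = g-surj y in
                 p u , ∈image⁺ p U u∈U , ∈∘ʰ⁺ g F (proj₁ (proj₂ chosen) u) y∈

  image-isMinTotal : ∀ {F} → IsSHE 𝒟 F → ∀ q → (∀ x → q x ∈ F x) → MinTotalSet 𝒟 (image q X)
  image-isMinTotal {F} F-she q q∈ = (F ∘ʰ h , ∘ʰ-isSHE 𝒟 F-she h-she , total)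
                                  , λ X′ w → ≤-trans (∣image∣≤∣p∣ q X) (X-minimal X′ w)
    where
    total : XTotal 𝒟 (image q X) (F ∘ʰ h)
    total d = let x , x∈X , x∈ = h-tot d in q x , ∈image⁺ q X x∈X , ∈∘ʰ⁺ F h x∈ (q∈ x)

  X-images-disjoint : ∀ {F} → IsSHE 𝒟 F → ∀ {x₁ x₂ y} → x₁ ∈ X → x₂ ∈ X → y ∈ F x₁ → y ∈ F x₂ → x₁ ≡ x₂
  X-images-disjoint {F} F-she {x₁} {x₂} {y} x₁∈X x₂∈X y∈₁ y∈₂ with x₁ ≟ᶠ x₂
  ... | yes x₁≡x₂ = x₁≡x₂
  ... | no x₁≢x₂ = contradiction (X-minimal (image q X) (proj₁ (image-isMinTotal F-she q (proj₁ (proj₂ chosen)))))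
                     (<⇒≱ (collision⇒∣image∣<∣p∣ q X x₁∈X x₂∈X x₁≢x₂ (trans (q-y y∈₁) (sym (q-y y∈₂)))))
    where
    chosen : Σ (Dom 𝒟 → Dom 𝒟) λ q → (∀ x → q x ∈ F x) × (∀ x → y ∈ F x → q x ≡ y)
    chosen = choice-through y (λ x → y ∈? F x) (she-nonempty 𝒟 F-she)
    q : Dom 𝒟 → Dom 𝒟
    q = proj₁ chosen
    q-y : ∀ {x} → y ∈ F x → q x ≡ y
    q-y = proj₂ (proj₂ chosen) _

  U⊎X : ∀ y → y ∈ U ⊎ y ∈ X
  U⊎X y = x∈p∪q⁻ U X (subst (y ∈_) (sym covering) ∈⊤)

  ∉U⇒∈X : ∀ {y} → y ∉ U → y ∈ X
  ∉U⇒∈X {y} y∉U with U⊎X y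
  ... | inj₁ y∈U = contradiction y∈U y∉U
  ... | inj₂ y∈X = y∈X

  data Part : Set where
    core onlyX onlyU : Part

  Block : Part → Subset (suc k)
  Block core  = X ∩ U
  Block onlyX = X ─ U
  Block onlyU = U ─ X

  locate : ∀ y → Σ Part λ p → y ∈ Block p
  locate y with y ∈? X | y ∈? U
  ... | yes y∈X | yes y∈U = core  , x∈p∩q⁺ (y∈X , y∈U)
  ... | yes y∈X | no  y∉U = onlyX , x∈p∧x∉q⇒x∈p─q y∈X y∉U
  ... | no  y∉X | yes y∈U = onlyU , x∈p∧x∉q⇒x∈p─q y∈U y∉X
  ... | no  y∉X | no  y∉U = contradiction (∉U⇒∈X y∉U) y∉X

  part : Dom 𝒟 → Part
  part y = proj₁ (locate y)

  Block-disjoint : ∀ {p q y} → y ∈ Block p → y ∈ Block q → p ≡ q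
  Block-disjoint {core}  {core}  _ _ = refl
  Block-disjoint {onlyX} {onlyX} _ _ = refl
  Block-disjoint {onlyU} {onlyU} _ _ = refl
  Block-disjoint {core}  {onlyX} y∈ y∈′ = contradiction (proj₂ (x∈p∩q⁻ X U y∈)) (x∈p─q⇒x∉q y∈′)
  Block-disjoint {core}  {onlyU} y∈ y∈′ = contradiction (proj₁ (x∈p∩q⁻ X U y∈)) (x∈p─q⇒x∉q y∈′)
  Block-disjoint {onlyX} {core}  y∈ y∈′ = contradiction (proj₂ (x∈p∩q⁻ X U y∈′)) (x∈p─q⇒x∉q y∈)
  Block-disjoint {onlyX} {onlyU} y∈ y∈′ = contradiction (p─q⊆p X U y∈) (x∈p─q⇒x∉q y∈′)
  Block-disjoint {onlyU} {core}  y∈ y∈′ = contradiction (proj₁ (x∈p∩q⁻ X U y∈′)) (x∈p─q⇒x∉q y∈)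
  Block-disjoint {onlyU} {onlyX} y∈ y∈′ = contradiction (p─q⊆p X U y∈′) (x∈p─q⇒x∉q y∈)

  ∈Block⇒part : ∀ p {y} → y ∈ Block p → part y ≡ p
  ∈Block⇒part _ {y} = Block-disjoint (proj₂ (locate y))

  part⇒∈Block : ∀ p {y} → part y ≡ p → y ∈ Block p
  part⇒∈Block _ {y} refl = proj₂ (locate y)

  part≡⇒∈Block : ∀ p {x y} → part x ≡ part y → x ∈ Block p → y ∈ Block p
  part≡⇒∈Block p eq x∈ = part⇒∈Block p (trans (sym eq) (∈Block⇒part p x∈))

  Block⊆X⊎Block⊆U : ∀ p → (Block p ⊆ X) ⊎ (Block p ⊆ U)
  Block⊆X⊎Block⊆U core  = inj₁ λ y∈ → proj₁ (x∈p∩q⁻ X U y∈)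
  Block⊆X⊎Block⊆U onlyX = inj₁ (p─q⊆p X U)
  Block⊆X⊎Block⊆U onlyU = inj₂ (p─q⊆p U X)

  -- The 3-permuted form with ζ, χ and υ glued into a single permutation θ of D.
  record UniformlyPermuted (F : HMap 𝒟) : Set where
    field
      θ           : Dom 𝒟 → Dom 𝒟
      θ-injective : ∀ {x y} → θ x ≡ θ y → x ≡ y
      θ-part      : ∀ d → part (θ d) ≡ part d
      θ∈          : ∀ d → θ d ∈ F d
      shape       : ∀ {d e} → e ∈ F d → e ≡ θ d ⊎ (d ∈ U ─ X × e ∈ X ─ U)

    θ-Block : ∀ p → MapsTo (Block p) (Block p) θ
    θ-Block p {d} d∈ = part≡⇒∈Block p (sym (θ-part d)) d∈

    θ-PermOn : ∀ p → PermOn 𝒟 (Block p) θ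
    θ-PermOn p = injective⇒PermOn 𝒟 (θ-Block p) λ _ _ → θ-injective

    θ-surjective : SurjectiveOn ⊤ θ
    θ-surjective = injective⇒surjective (λ _ → ∈⊤) λ _ _ → θ-injective

    θ⁻¹ : Dom 𝒟 → Dom 𝒟
    θ⁻¹ z = proj₁ (θ-surjective (∈⊤ {x = z}))

    θ∘θ⁻¹ : ∀ z → θ (θ⁻¹ z) ≡ z
    θ∘θ⁻¹ z = proj₂ (proj₂ (θ-surjective (∈⊤ {x = z})))

    θ≡⇒≡θ⁻¹ : ∀ {y z} → θ y ≡ z → y ≡ θ⁻¹ z
    θ≡⇒≡θ⁻¹ {z = z} θy≡z = θ-injective (trans θy≡z (sym (θ∘θ⁻¹ z)))

    θ⁻¹-injective : ∀ {x y} → θ⁻¹ x ≡ θ⁻¹ y → x ≡ y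
    θ⁻¹-injective {x} {y} eq = trans (sym (θ∘θ⁻¹ x)) (trans (cong θ eq) (θ∘θ⁻¹ y))

    θ⁻¹-part : ∀ z → part (θ⁻¹ z) ≡ part z
    θ⁻¹-part z = trans (sym (θ-part (θ⁻¹ z))) (cong part (θ∘θ⁻¹ z))

    only-θ-in-U : ∀ {d e} → e ∈ F d → e ∈ U ─ X → part d ≡ onlyU
    only-θ-in-U {d} e∈ e∈U─X with shape e∈
    ... | inj₁ refl         = trans (sym (θ-part d)) (∈Block⇒part onlyU e∈U─X)
    ... | inj₂ (d∈U─X , _) = ∈Block⇒part onlyU d∈U─X

  UniformlyPermuted⇒ThreePermuted : ∀ {F} → UniformlyPermuted F → ThreePermuted 𝒟 U X F
  UniformlyPermuted⇒ThreePermuted {F} F-up = record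
    { ζ = θ ; χ = θ ; υ = θ
    ; Xs = λ u → F u ∩ (X ─ U)
    ; ζ-perm = θ-PermOn core
    ; χ-perm = θ-PermOn onlyX
    ; υ-perm = θ-PermOn onlyU
    ; ζ-form = λ y y∈U∩X → singleton-intro (θ∈ y) (only-θ (proj₂ (x∈p∩q⁻ U X y∈U∩X)))
    ; χ-form = λ x x∈X─U → singleton-intro (θ∈ x) (only-θ (p─q⊆p X U x∈X─U))
    ; υ-form = λ u u∈U─X → ⊆-antisym (⊆υ-form u∈U─X) (υ-form⊆ u)
    ; Xs-sub = λ u _ → p∩q⊆q (F u) (X ─ U)
    }
    where
    open UniformlyPermuted F-up
    only-θ : ∀ {x e} → x ∈ X → e ∈ F x → e ≡ θ x
    only-θ x∈X e∈ with shape e∈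
    ... | inj₁ e≡θx          = e≡θx
    ... | inj₂ (x∈U─X , _) = contradiction x∈X (x∈p─q⇒x∉q x∈U─X)
    ⊆υ-form : ∀ {u} → u ∈ U ─ X → F u ⊆ ⁅ θ u ⁆ ∪ (F u ∩ (X ─ U))
    ⊆υ-form {u} _ {e} e∈ with shape e∈
    ... | inj₁ refl         = x∈p∪q⁺ (inj₁ (x∈⁅x⁆ (θ u)))
    ... | inj₂ (_ , e∈X─U) = x∈p∪q⁺ (inj₂ (x∈p∩q⁺ (e∈ , e∈X─U)))
    υ-form⊆ : ∀ u → ⁅ θ u ⁆ ∪ (F u ∩ (X ─ U)) ⊆ F u
    υ-form⊆ u e∈ with x∈p∪q⁻ ⁅ θ u ⁆ (F u ∩ (X ─ U)) e∈
    ... | inj₁ e∈⁅θu⁆ = subst (_∈ F u) (sym (x∈⁅y⁆⇒x≡y (θ u) e∈⁅θu⁆)) (θ∈ u)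
    ... | inj₂ e∈Fu∩ = p∩q⊆p (F u) (X ─ U) e∈Fu∩

  module _ {H : HMap 𝒟} (H-she : IsSHE 𝒟 H) (H-surj : USurjective 𝒟 U H) (H-tot : XTotal 𝒟 X H) where
    private
      σ : Dom 𝒟 → Dom 𝒟
      σ d = proj₁ (H-tot d)

      σ∈X : ∀ d → σ d ∈ X
      σ∈X d = proj₁ (proj₂ (H-tot d))

      σ∈H : ∀ d → σ d ∈ H d
      σ∈H d = proj₂ (proj₂ (H-tot d))

      σ-injective : InjectiveOn X σ
      σ-injective {x₁} {x₂} x₁∈X x₂∈X eq =
        X-images-disjoint H-she x₁∈X x₂∈X (σ∈H x₁) (subst (_∈ H x₂) (sym eq) (σ∈H x₂))

      X∩H-unique : ∀ {x e} → x ∈ X → e ∈ X → e ∈ H x → e ≡ σ x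
      X∩H-unique x∈X e∈X e∈ with injective⇒surjective (λ {x} _ → σ∈X x) σ-injective e∈X
      ... | x′ , x′∈X , refl = cong σ (X-images-disjoint H-she x′∈X x∈X (σ∈H x′) e∈)

      ψ : Dom 𝒟 → Dom 𝒟
      ψ d = proj₁ (H-surj d)

      ψ∈U : ∀ d → ψ d ∈ U
      ψ∈U d = proj₁ (proj₂ (H-surj d))

      ∈H∘ψ : ∀ d → d ∈ H (ψ d)
      ∈H∘ψ d = proj₂ (proj₂ (H-surj d))

      ψ-surjective : SurjectiveOn U ψ
      ψ-surjective = injective⇒surjective (λ {u} _ → ψ∈U u) λ {u₁} {u₂} u₁∈U u₂∈U eq →
        U-images-subsingleton H-she u₁∈U u₂∈U (∈H∘ψ u₁) (subst (λ d → u₂ ∈ H d) (sym eq) (∈H∘ψ u₂))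

      θ : Dom 𝒟 → Dom 𝒟
      θ d = choose (λ e → (e ∈? U) ×-dec (e ∈? H d)) (σ d)

      θ∈H : ∀ d → θ d ∈ H d
      θ∈H d with choose-default (λ e → (e ∈? U) ×-dec (e ∈? H d)) (σ d)
      ... | inj₁ (_ , θd∈) = θd∈
      ... | inj₂ θd≡σd     = subst (_∈ H d) (sym θd≡σd) (σ∈H d)

      θ∈U : ∀ {d e} → e ∈ U → e ∈ H d → θ d ∈ U
      θ∈U {d} e∈U e∈ = proj₁ (choose-spec (λ e → (e ∈? U) ×-dec (e ∈? H d)) (σ d) (_ , e∈U , e∈))

      U∩H-unique : ∀ {d e} → e ∈ U → e ∈ H d → e ≡ θ d
      U∩H-unique {d} e∈U e∈ = U-images-subsingleton H-she e∈U (θ∈U e∈U e∈) e∈ (θ∈H d)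

      θ-U : MapsTo U U θ
      θ-U u∈U with ψ-surjective u∈U
      ... | w , w∈U , refl = θ∈U w∈U (∈H∘ψ w)

      θ-injectiveOnU : InjectiveOn U θ
      θ-injectiveOnU u₁∈U u₂∈U eq with ψ-surjective u₁∈U | ψ-surjective u₂∈U
      ... | w₁ , w₁∈U , refl | w₂ , w₂∈U , refl =
        cong ψ (trans (U∩H-unique w₁∈U (∈H∘ψ w₁)) (trans eq (sym (U∩H-unique w₂∈U (∈H∘ψ w₂)))))

      θ-injectiveOnX : InjectiveOn X θ
      θ-injectiveOnX {x₁} {x₂} x₁∈X x₂∈X eq =
        X-images-disjoint H-she x₁∈X x₂∈X (θ∈H x₁) (subst (_∈ H x₂) (sym eq) (θ∈H x₂))

      -- Otherwise θ embeds (U ∩ X) ∪ ⁅ b ⁆ into U ∩ image θ X, and image θ X is again a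
      -- minimum total set: this contradicts the maximality of |U ∩ X|.
      X─U-avoids-U : ∀ {b e} → b ∈ X ─ U → e ∈ U → e ∈ H b → ⊥
      X─U-avoids-U {b} {e} b∈X─U e∈U e∈ = <⇒≱ ∣U∩X∣<∣S∣ (≤-trans ∣S∣≤∣U∩Q∣ ∣U∩Q∣≤∣U∩X∣)
        where
        Q : Subset (suc k)
        Q = image θ X
        S : Subset (suc k)
        S = (U ∩ X) ∪ ⁅ b ⁆
        ∣U∩Q∣≤∣U∩X∣ : ∣ U ∩ Q ∣ ≤ ∣ U ∩ X ∣
        ∣U∩Q∣≤∣U∩X∣ = U∩X-maximal U Q (proj₁ selected) (image-isMinTotal H-she θ θ∈H)
        ∣U∩X∣<∣S∣ : ∣ U ∩ X ∣ < ∣ S ∣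
        ∣U∩X∣<∣S∣ = p⊂q⇒∣p∣<∣q∣ (p⊆p∪q ⁅ b ⁆ , b , x∈p∪q⁺ (inj₂ (x∈⁅x⁆ b)) ,
                                 λ b∈U∩X → x∈p─q⇒x∉q b∈X─U (proj₁ (x∈p∩q⁻ U X b∈U∩X)))
        S⊆X : S ⊆ X
        S⊆X x∈S with x∈p∪q⁻ (U ∩ X) ⁅ b ⁆ x∈S
        ... | inj₁ x∈U∩X = proj₂ (x∈p∩q⁻ U X x∈U∩X)
        ... | inj₂ x∈⁅b⁆ = subst (_∈ X) (sym (x∈⁅y⁆⇒x≡y b x∈⁅b⁆)) (p─q⊆p X U b∈X─U)
        θ-S : MapsTo S (U ∩ Q) θ
        θ-S x∈S with x∈p∪q⁻ (U ∩ X) ⁅ b ⁆ x∈S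
        ... | inj₁ x∈U∩X = x∈p∩q⁺ (θ-U (proj₁ (x∈p∩q⁻ U X x∈U∩X)) , ∈image⁺ θ X (S⊆X x∈S))
        ... | inj₂ x∈⁅b⁆ rewrite x∈⁅y⁆⇒x≡y b x∈⁅b⁆ = x∈p∩q⁺ (θ∈U e∈U e∈ , ∈image⁺ θ X (S⊆X x∈S))
        ∣S∣≤∣U∩Q∣ : ∣ S ∣ ≤ ∣ U ∩ Q ∣
        ∣S∣≤∣U∩Q∣ = injection⇒∣p∣≤∣q∣ θ-S λ x∈S y∈S → θ-injectiveOnX (S⊆X x∈S) (S⊆X y∈S)

      σ-X─U : MapsTo (X ─ U) (X ─ U) σ
      σ-X─U {b} b∈X─U = x∈p∧x∉q⇒x∈p─q (σ∈X b) λ σb∈U → X─U-avoids-U b∈X─U σb∈U (σ∈H b)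

      σ-X∩U : MapsTo (X ∩ U) (X ∩ U) σ
      σ-X∩U {a} a∈X∩U with σ a ∈? U
      ... | yes σa∈U = x∈p∩q⁺ (σ∈X a , σa∈U)
      ... | no σa∉U with injective⇒surjective σ-X─U (λ x∈ y∈ → σ-injective (p─q⊆p X U x∈) (p─q⊆p X U y∈))
                                                  (x∈p∧x∉q⇒x∈p─q (σ∈X a) σa∉U)
      ...   | b , b∈X─U , σb≡σa = contradiction (proj₂ (x∈p∩q⁻ X U a∈X∩U)) (subst (_∉ U) b≡a (x∈p─q⇒x∉q b∈X─U))
        where
        b≡a : b ≡ a
        b≡a = σ-injective (p─q⊆p X U b∈X─U) (proj₁ (x∈p∩q⁻ X U a∈X∩U)) σb≡σa

      θ≡σ-on-X : ∀ {x} → x ∈ X → θ x ≡ σ x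
      θ≡σ-on-X {x} x∈X with x ∈? U
      ... | yes x∈U = sym (U∩H-unique (proj₂ (x∈p∩q⁻ X U (σ-X∩U (x∈p∩q⁺ (x∈X , x∈U))))) (σ∈H x))
      ... | no x∉U with choose-default (λ e → (e ∈? U) ×-dec (e ∈? H x)) (σ x)
      ...   | inj₁ (θx∈U , θx∈) = ⊥-elim (X─U-avoids-U (x∈p∧x∉q⇒x∈p─q x∈X x∉U) θx∈U θx∈)
      ...   | inj₂ θx≡σx         = θx≡σx

      X∩H-is-θ : ∀ {x e} → x ∈ X → e ∉ U → e ∈ H x → e ≡ θ x
      X∩H-is-θ x∈X e∉U e∈ = trans (X∩H-unique x∈X (∉U⇒∈X e∉U) e∈) (sym (θ≡σ-on-X x∈X))

      θ-X∩U : MapsTo (X ∩ U) (X ∩ U) θ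
      θ-X∩U a∈ = subst (_∈ X ∩ U) (sym (θ≡σ-on-X (proj₁ (x∈p∩q⁻ X U a∈)))) (σ-X∩U a∈)

      θ-X─U : MapsTo (X ─ U) (X ─ U) θ
      θ-X─U b∈ = subst (_∈ X ─ U) (sym (θ≡σ-on-X (p─q⊆p X U b∈))) (σ-X─U b∈)

      θ-U─X : MapsTo (U ─ X) (U ─ X) θ
      θ-U─X {c} c∈ with θ c ∈? X
      ... | no θc∉X = x∈p∧x∉q⇒x∈p─q (θ-U (p─q⊆p U X c∈)) θc∉X
      ... | yes θc∈X with injective⇒surjective θ-X∩U (λ x∈ y∈ → θ-injectiveOnX (proj₁ (x∈p∩q⁻ X U x∈)) (proj₁ (x∈p∩q⁻ X U y∈)))
                                               (x∈p∩q⁺ (θc∈X , θ-U (p─q⊆p U X c∈)))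
      ...   | a , a∈X∩U , θa≡θc = contradiction (subst (_∈ X) a≡c (proj₁ (x∈p∩q⁻ X U a∈X∩U))) (x∈p─q⇒x∉q c∈)
        where
        a≡c : a ≡ c
        a≡c = θ-injectiveOnU (proj₂ (x∈p∩q⁻ X U a∈X∩U)) (p─q⊆p U X c∈) θa≡θc

      θ-Block : ∀ p → MapsTo (Block p) (Block p) θ
      θ-Block core  = θ-X∩U
      θ-Block onlyX = θ-X─U
      θ-Block onlyU = θ-U─X

    USurjective∧XTotal⇒UniformlyPermuted : UniformlyPermuted H
    USurjective∧XTotal⇒UniformlyPermuted = record
      { θ = θ ; θ-injective = θ-injective ; θ-part = θ-part ; θ∈ = θ∈H ; shape = shape }
      where
      θ-part : ∀ d → part (θ d) ≡ part d
      θ-part d = ∈Block⇒part (part d) (θ-Block (part d) (proj₂ (locate d)))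

      θ-injective : ∀ {x y} → θ x ≡ θ y → x ≡ y
      θ-injective {x} {y} eq = by-side (Block⊆X⊎Block⊆U (part x))
        where
        x∈ : x ∈ Block (part x)
        x∈ = proj₂ (locate x)
        y∈ : y ∈ Block (part x)
        y∈ = part≡⇒∈Block (part x) (trans (sym (θ-part x)) (trans (cong part eq) (θ-part y))) x∈
        by-side : (Block (part x) ⊆ X) ⊎ (Block (part x) ⊆ U) → x ≡ y
        by-side (inj₁ ⊆X) = θ-injectiveOnX (⊆X x∈) (⊆X y∈) eq
        by-side (inj₂ ⊆U) = θ-injectiveOnU (⊆U x∈) (⊆U y∈) eq

      shape : ∀ {d e} → e ∈ H d → e ≡ θ d ⊎ (d ∈ U ─ X × e ∈ X ─ U)
      shape {d} {e} e∈ with locate d | e ∈? U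
      ... | core  , d∈X∩U | yes e∈U = inj₁ (U∩H-unique e∈U e∈)
      ... | core  , d∈X∩U | no e∉U  = inj₁ (X∩H-is-θ (proj₁ (x∈p∩q⁻ X U d∈X∩U)) e∉U e∈)
      ... | onlyX , d∈X─U | yes e∈U = ⊥-elim (X─U-avoids-U d∈X─U e∈U e∈)
      ... | onlyX , d∈X─U | no e∉U  = inj₁ (X∩H-is-θ (p─q⊆p X U d∈X─U) e∉U e∈)
      ... | onlyU , d∈U─X | yes e∈U = inj₁ (U∩H-unique e∈U e∈)
      ... | onlyU , d∈U─X | no e∉U  = inj₂ (d∈U─X , x∈p∧x∉q⇒x∈p─q (∉U⇒∈X e∉U) e∉U)

  sandwich : ∀ {K F} → UniformlyPermuted K → UniformlyPermuted (K ∘ʰ (F ∘ʰ K)) → UniformlyPermuted F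
  sandwich {K} {F} K-up G-up = record
    { θ = φ ; θ-injective = φ-injective ; θ-part = φ-part ; θ∈ = φ∈ ; shape = F-shape }
    where
    module K = UniformlyPermuted K-up
    module G = UniformlyPermuted G-up

    κ : Dom 𝒟 → Dom 𝒟
    κ z = G.θ (K.θ⁻¹ z)

    κ-part : ∀ z → part (κ z) ≡ part z
    κ-part z = trans (G.θ-part (K.θ⁻¹ z)) (K.θ⁻¹-part z)

    φ : Dom 𝒟 → Dom 𝒟
    φ z = K.θ⁻¹ (κ z)

    φ-part : ∀ z → part (φ z) ≡ part z
    φ-part z = trans (K.θ⁻¹-part (κ z)) (κ-part z)

    φ-injective : ∀ {z₁ z₂} → φ z₁ ≡ φ z₂ → z₁ ≡ z₂
    φ-injective eq = K.θ⁻¹-injective (G.θ-injective (K.θ⁻¹-injective eq))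

    ∈K∘θ⁻¹ : ∀ z → z ∈ K (K.θ⁻¹ z)
    ∈K∘θ⁻¹ z = subst (_∈ K (K.θ⁻¹ z)) (K.θ∘θ⁻¹ z) (K.θ∈ (K.θ⁻¹ z))

    θ-of-image : ∀ {z e} → e ∈ F z → K.θ e ≡ κ z ⊎ (z ∈ U ─ X × e ∈ X ─ U)
    θ-of-image {z} {e} e∈ with G.shape (∈∘ʰ⁺ K (F ∘ʰ K) (∈∘ʰ⁺ F K (∈K∘θ⁻¹ z) e∈) (K.θ∈ e))
    ... | inj₁ θe≡κz              = inj₁ θe≡κz
    ... | inj₂ (x∈U─X , θe∈X─U) =
      inj₂ (part≡⇒∈Block onlyU (K.θ⁻¹-part z) x∈U─X , part≡⇒∈Block onlyX (K.θ-part e) θe∈X─U)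

    θ≡κ-if-κ∈K : ∀ {z t} → t ∈ F z → κ z ∈ K t → K.θ t ≡ κ z
    θ≡κ-if-κ∈K {z} t∈ κz∈ with K.shape κz∈ | θ-of-image t∈
    ... | inj₁ κz≡θt       | _                 = sym κz≡θt
    ... | inj₂ _           | inj₁ θt≡κz       = θt≡κz
    ... | inj₂ (t∈U─X , _) | inj₂ (_ , t∈X─U) = contradiction (Block-disjoint {onlyU} {onlyX} t∈U─X t∈X─U) λ ()

    κ[U─X]∉K∘F[X─U] : ∀ {z s t} → z ∈ U ─ X → s ∈ X ─ U → t ∈ F s → κ z ∈ K t → ⊥
    κ[U─X]∉K∘F[X─U] {z} {s} {t} z∈U─X s∈X─U t∈ κz∈ with θ-of-image t∈
    ... | inj₁ θt≡κs = contradiction (trans (sym part-t≡onlyU) part-t≡onlyX) λ ()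
      where
      open ≡-Reasoning
      part-t≡onlyU : part t ≡ onlyU
      part-t≡onlyU = K.only-θ-in-U κz∈ (part≡⇒∈Block onlyU (sym (κ-part z)) z∈U─X)
      part-t≡onlyX : part t ≡ onlyX
      part-t≡onlyX = begin
        part t       ≡⟨ K.θ-part t ⟨
        part (K.θ t) ≡⟨ cong part θt≡κs ⟩
        part (κ s)   ≡⟨ κ-part s ⟩
        part s       ≡⟨ ∈Block⇒part onlyX s∈X─U ⟩
        onlyX        ∎
    ... | inj₂ (s∈U─X , _) = contradiction (Block-disjoint {onlyU} {onlyX} s∈U─X s∈X─U) λ ()

    κ-attained : ∀ z → Σ (Dom 𝒟) λ y → y ∈ F z × K.θ y ≡ κ z
    κ-attained z with ∈∘ʰ⁻ K (F ∘ʰ K) (G.θ∈ (K.θ⁻¹ z))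
    ... | t , t∈ , κz∈ with ∈∘ʰ⁻ F K t∈
    ...   | s , s∈ , t∈Fs with K.shape s∈
    ...     | inj₁ refl = t , t∈Fz , θ≡κ-if-κ∈K t∈Fz κz∈
      where
      t∈Fz : t ∈ F z
      t∈Fz = subst (λ w → t ∈ F w) (K.θ∘θ⁻¹ z) t∈Fs
    ...     | inj₂ (x∈U─X , s∈X─U) = ⊥-elim (κ[U─X]∉K∘F[X─U] (part≡⇒∈Block onlyU (K.θ⁻¹-part z) x∈U─X) s∈X─U t∈Fs κz∈)

    φ∈ : ∀ z → φ z ∈ F z
    φ∈ z = let y , y∈ , θy≡κz = κ-attained z in subst (_∈ F z) (K.θ≡⇒≡θ⁻¹ θy≡κz) y∈

    F-shape : ∀ {z e} → e ∈ F z → e ≡ φ z ⊎ (z ∈ U ─ X × e ∈ X ─ U)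
    F-shape e∈ with θ-of-image e∈
    ... | inj₁ θe≡κz = inj₁ (K.θ≡⇒≡θ⁻¹ θe≡κz)
    ... | inj₂ extra  = inj₂ extra

  SHE⇒UniformlyPermuted : ∀ {F} → IsSHE 𝒟 F → UniformlyPermuted F
  SHE⇒UniformlyPermuted {F} F-she =
    sandwich (USurjective∧XTotal⇒UniformlyPermuted K-she K-surj K-tot)
             (USurjective∧XTotal⇒UniformlyPermuted G-she G-surj G-tot)
    where
    K : HMap 𝒟
    K = h ∘ʰ g
    K-she : IsSHE 𝒟 K
    K-she = ∘ʰ-isSHE 𝒟 h-she g-she
    K-surj : USurjective 𝒟 U K
    K-surj = ∘ʰ-USurjective 𝒟 h-she g-surj
    K-tot : XTotal 𝒟 X K
    K-tot = ∘ʰ-XTotal 𝒟 h-tot g-she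
    F∘K-she : IsSHE 𝒟 (F ∘ʰ K)
    F∘K-she = ∘ʰ-isSHE 𝒟 F-she K-she
    G-she : IsSHE 𝒟 (K ∘ʰ (F ∘ʰ K))
    G-she = ∘ʰ-isSHE 𝒟 K-she F∘K-she
    G-surj : USurjective 𝒟 U (K ∘ʰ (F ∘ʰ K))
    G-surj = ∘ʰ-USurjective 𝒟 K-she (∘ʰ-USurjective 𝒟 F-she K-surj)
    G-tot : XTotal 𝒟 X (K ∘ʰ (F ∘ʰ K))
    G-tot = ∘ʰ-XTotal 𝒟 K-tot F∘K-she

theorem12 : (𝒟 : Structure) (U X : Subset (Data.Nat.suc (Structure.k 𝒟))) → SelectedUX 𝒟 U X → U ∪ X ≡ ⊤ →
    ((f : HMap 𝒟) → IsSHE 𝒟 f → ThreePermuted 𝒟 U X f) ×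
    ((f : HMap 𝒟) → IsSHE 𝒟 f → USurjective 𝒟 U f → XTotal 𝒟 X f →
      (w : ThreePermuted 𝒟 U X f) →
        (∀ y → ((y ∈ X × InImage 𝒟 f (U ─ X) y) ⇔ (Σ (Dom 𝒟) λ u → u ∈ U ─ X × y ∈ ThreePermuted.Xs w u))) ×
        (∀ y → ((Σ (Dom 𝒟) λ u → u ∈ U ─ X × y ∈ ThreePermuted.Xs w u) ⇔ y ∈ X ─ U)))
theorem12 𝒟 U X selected covering =
  (λ f f-she → UniformlyPermuted⇒ThreePermuted (SHE⇒UniformlyPermuted f-she)) ,
  (λ f _ f-surj _ w → X∩f[U─X]⇔⋃Xs 𝒟 w , ⋃Xs⇔X─U 𝒟 w f-surj)
  where open UXCore 𝒟 selected covering
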